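{- Let $B$ be a bipartite graph with at most one cycle and maximum degree $\Delta$. Then $\chi_i(B) \leq \Delta + 2$.
   Context: For a graph $G$, let $D(G)$ be the digraph obtained by replacing each edge $uv$ by the two opposite arcs $uv$ and $vu$, with arc set $A(G)$. Two distinct arcs $uv$ and $xy$ are adjacent if $u=x$, or $v=x$, or $y=u$. An incidence coloring is a map $\sigma: A(G)\to C$ assigning distinct colors to adjacent arcs; the incidence chromatic number $\chi_i(G)$ is the minimum $|C|$ over all incidence colorings. -}

module Defs where

open import Data.Nat using (ℕ; zero; suc; _+_; _≤_; _⊔_)
open import Data.Bool using (Bool; true; false; if_then_else_)
open import Data.Fin using (Fin; inject₁; fromℕ) renaming (zero to fzero; suc to fsuc)
open import Data.List using (List; map; allFin; foldr)
open import Data.Nat.ListAction using (sum)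
open import Data.Product using (Σ; ∃; _×_; _,_)
open import Data.Sum using (_⊎_)
open import Relation.Binary.PropositionalEquality using (_≡_; _≢_)
open import Relation.Nullary using (¬_)
open import Function.Definitions using (Injective)

record Graph (n : ℕ) : Set where
  field
    adj     : Fin n → Fin n → Bool
    sym     : ∀ u v → adj u v ≡ adj v u
    irrefl  : ∀ v → adj v v ≡ false
open Graph public

deg : ∀ {n} → Graph n → Fin n → ℕ
deg {n} G u = sum (map (λ v → if adj G u v then 1 else 0) (allFin n))

maxDeg : ∀ {n} → Graph n → ℕ
maxDeg {n} G = foldr (λ u m → deg G u ⊔ m) 0 (allFin n)

Bipartite : ∀ {n} → Graph n → Set
Bipartite {n} G = Σ (Fin n → Bool) λ f → ∀ u v → adj G u v ≡ true → f u ≢ f v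

-- A cycle v_0 v_1 ... v_m v_0 of length m+1 ≥ 3 with distinct vertices.
record Cycle {n : ℕ} (G : Graph n) : Set where
  field
    m      : ℕ
    len≥3  : 2 ≤ m
    vs     : Fin (suc m) → Fin n
    inj    : Injective _≡_ _≡_ vs
    step   : ∀ (i : Fin m) → adj G (vs (inject₁ i)) (vs (fsuc i)) ≡ true
    close  : adj G (vs (fromℕ m)) (vs fzero) ≡ true
open Cycle public

CycleEdge : ∀ {n} {G : Graph n} → Cycle G → Fin n → Fin n → Set
CycleEdge C u v =
  (∃ λ (i : Fin (m C)) →
      (u ≡ vs C (inject₁ i) × v ≡ vs C (fsuc i)) ⊎ (v ≡ vs C (inject₁ i) × u ≡ vs C (fsuc i)))
  ⊎ ((u ≡ vs C (fromℕ (m C)) × v ≡ vs C fzero) ⊎ (v ≡ vs C (fromℕ (m C)) × u ≡ vs C fzero))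

-- G has at most one cycle: any two cycles have the same edge set
-- (i.e. they are the same cycle subgraph).
AtMostOneCycle : ∀ {n} → Graph n → Set
AtMostOneCycle G = ∀ (C D : Cycle G) → ∀ u v →
  (CycleEdge C u v → CycleEdge D u v) × (CycleEdge D u v → CycleEdge C u v)

Arc : ∀ {n} → Graph n → Set
Arc {n} G = Σ (Fin n × Fin n) λ { (u , v) → adj G u v ≡ true }

ArcAdj : ∀ {n} (G : Graph n) → Arc G → Arc G → Set
ArcAdj G ((u , v) , _) ((x , y) , _) =
  ((u , v) ≢ (x , y)) × ((u ≡ x) ⊎ (v ≡ x) ⊎ (y ≡ u))

IncidenceColoring : ∀ {n} (G : Graph n) → Set → Set
IncidenceColoring G C = Σ (Arc G → C) λ σ → ∀ a b → ArcAdj G a b → σ a ≢ σ b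

χi≤ : ∀ {n} → Graph n → ℕ → Set
χi≤ G k = IncidenceColoring G (Fin k)

-- Colouring each arc uv by c v, where c is a vertex colouring in which vertices at distance one or
-- two get different colours (a proper colouring of the square of B), yields an incidence colouring.
-- Such a c with Δ + 2 colours is built by deleting leaves: a leaf p with neighbour q is within
-- distance two only of q and the other neighbours of q, at most Δ vertices, so a colour is left for p.
-- In a graph without leaves each end of a path that cannot be prolonged closes a cycle; as there is
-- only one cycle, it must contain both ends, hence the whole path. So every edge lies on the cycle,
-- and the graph is the cycle plus isolated vertices. Being even, the cycle has length 4r + 3q, and the
-- colours 0123 repeated r times followed by 012 repeated q times work; Δ ≥ 2 makes four colours available.

module Submission where

open import Defs hiding (sym)
open import Data.Nat using (ℕ; zero; suc; _+_; _*_; _≤_; _<_; z≤n; s≤s; _⊔_)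
open import Data.Nat.Properties as ℕ using (≤-refl; ≤-trans; <-≤-trans; m≤m⊔n; m≤n⊔m)
open import Data.Nat.ListAction using (sum)
import Data.Bool.Properties as Boolₚ
open import Data.Bool as Bool using (Bool; true; false; if_then_else_; _∧_; not)
open import Data.Fin as Fin using (Fin; inject₁; fromℕ; toℕ; _≟_; #_) renaming (zero to fzero; suc to fsuc)
open import Data.Fin.Properties using (injective⇒≤; all?; any?; ¬∀⟶∃¬; inject≤-injective; inject₁-injective; fromℕ≢inject₁; toℕ-inject₁; toℕ-fromℕ)
open import Data.List using (List; []; _∷_; _++_; [_]; _∷ʳ_; reverse; length; lookup; filter; map; allFin; foldr)
open import Data.List.Properties using (length-tabulate; length-map; filter-notAll; length-reverse; length-++; ++-identityʳ; unfold-reverse; reverse-++; reverse-involutive; ++-assoc; ∷-injectiveʳ)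
open import Data.List.Membership.Propositional using (_∈_; _∉_)
open import Data.List.Membership.Propositional.Properties using (∈-++⁺ˡ; ∈-++⁺ʳ; ∈-map⁺; ∈-∃++; ∈-lookup; ∈-allFin; ∈-filter⁺; ∈-filter⁻)
open import Data.List.Relation.Binary.Subset.Propositional using (_⊆_)
open import Data.List.Relation.Unary.All as All using (All; []; _∷_)
open import Data.List.Relation.Unary.All.Properties using (++⁻ˡ; ¬Any⇒All¬)
open import Data.List.Relation.Unary.Any as Any using (here; there; index)
open import Data.List.Relation.Unary.Any.Properties using (lookup-index)
open import Data.List.Relation.Unary.Unique.Propositional using (Unique; []; _∷_)
open import Data.List.Relation.Unary.Unique.Propositional.Properties using (allFin⁺; filter⁺)
open import Data.Product using (Σ; ∃; ∃₂; _×_; _,_; proj₁; proj₂)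
open import Data.Sum using (_⊎_; inj₁; inj₂)
open import Data.Empty using (⊥; ⊥-elim)
open import Relation.Nullary using (¬?; yes; no; does; _×-dec_)
open import Relation.Nullary.Decidable using (decidable-stable)
open import Relation.Binary.PropositionalEquality hiding ([_])
open import Function.Definitions using (Injective)
open import Function.Base using (_∘_; case_of_)

open import Algebra.Properties.CommutativeSemigroup ℕ.+-commutativeSemigroup using (x∙yz≈y∙xz)

import Data.List.Relation.Binary.Permutation.Setoid as Permutation
import Data.List.Relation.Binary.Permutation.Setoid.Properties as PermutationProperties

module _ {A : Set} where

  data Consec (u v : A) : List A → Set where
    here  : ∀ {xs} → Consec u v (u ∷ v ∷ xs)
    there : ∀ {x xs} → Consec u v xs → Consec u v (x ∷ xs)

  consec-++⁺ˡ : ∀ {u v xs} ys → Consec u v xs → Consec u v (xs ++ ys)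
  consec-++⁺ˡ ys here      = here
  consec-++⁺ˡ ys (there c) = there (consec-++⁺ˡ ys c)

  consec-++⁺ʳ : ∀ {u v ys} xs → Consec u v ys → Consec u v (xs ++ ys)
  consec-++⁺ʳ []       c = c
  consec-++⁺ʳ (x ∷ xs) c = there (consec-++⁺ʳ xs c)

  consec-reverse⁺ : ∀ {u v xs} → Consec u v xs → Consec v u (reverse xs)
  consec-reverse⁺ {u} {v} (here {xs}) =
    subst (Consec v u) (sym (reverse-++ (u ∷ v ∷ []) xs)) (consec-++⁺ʳ (reverse xs) here)
  consec-reverse⁺ (there {x} {xs} c) =
    subst (Consec _ _) (sym (unfold-reverse x xs)) (consec-++⁺ˡ [ x ] (consec-reverse⁺ c))

  consec-lookup⁺ : ∀ (a : A) t (i : Fin (length t)) →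
    Consec (lookup (a ∷ t) (inject₁ i)) (lookup (a ∷ t) (fsuc i)) (a ∷ t)
  consec-lookup⁺ a (b ∷ t) fzero    = here
  consec-lookup⁺ a (b ∷ t) (fsuc i) = there (consec-lookup⁺ b t i)

  consec-lookup⁻ : ∀ {u v} (a : A) t → Consec u v (a ∷ t) →
    ∃ λ (i : Fin (length t)) → u ≡ lookup (a ∷ t) (inject₁ i) × v ≡ lookup (a ∷ t) (fsuc i)
  consec-lookup⁻ a (b ∷ t) here = fzero , refl , refl
  consec-lookup⁻ a (b ∷ t) (there c) with i , u≡ , v≡ ← consec-lookup⁻ b t c = fsuc i , u≡ , v≡

  lookup-last : ∀ (a : A) s z → lookup (a ∷ s ∷ʳ z) (fromℕ (length (s ∷ʳ z))) ≡ z
  lookup-last a []      z = refl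
  lookup-last a (b ∷ s) z = lookup-last b s z

  unique-++⁻ˡ : ∀ xs {ys : List A} → Unique (xs ++ ys) → Unique xs
  unique-++⁻ˡ []       _          = []
  unique-++⁻ˡ (x ∷ xs) (x∉ ∷ xs!) = ++⁻ˡ xs x∉ ∷ unique-++⁻ˡ xs xs!

  unique-++-disjoint : ∀ xs {ys : List A} {x} → Unique (xs ++ ys) → x ∈ xs → x ∉ ys
  unique-++-disjoint (x ∷ xs) (x∉ ∷ _)   (here refl) x∈ys = All.lookup x∉ (∈-++⁺ʳ xs x∈ys) refl
  unique-++-disjoint (x ∷ xs) (_ ∷ xs!) (there x∈xs) = unique-++-disjoint xs xs! x∈xs

  unique-reverse⁺ : ∀ {xs : List A} → Unique xs → Unique (reverse xs)
  unique-reverse⁺ {xs} = Unique-resp-↭ (↭-sym (↭-reverse xs))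
    where
    open Permutation (setoid A) using (↭-sym)
    open PermutationProperties (setoid A) using (Unique-resp-↭; ↭-reverse)

  unique⇒lookup-injective : ∀ {xs : List A} → Unique xs → Injective _≡_ _≡_ (lookup xs)
  unique⇒lookup-injective (x∉ ∷ _)  {fzero}  {fzero}  _ = refl
  unique⇒lookup-injective (x∉ ∷ _)  {fzero}  {fsuc j} e = ⊥-elim (All.lookup x∉ (∈-lookup j) e)
  unique⇒lookup-injective (x∉ ∷ _)  {fsuc i} {fzero}  e = ⊥-elim (All.lookup x∉ (∈-lookup i) (sym e))
  unique⇒lookup-injective (_ ∷ xs!) {fsuc i} {fsuc j} e = cong fsuc (unique⇒lookup-injective xs! e)

  unique⊆⇒length≤ : ∀ {xs ys : List A} → Unique xs → xs ⊆ ys → length xs ≤ length ys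
  unique⊆⇒length≤ {xs} {ys} xs! xs⊆ys = injective⇒≤ position-injective
    where
    position : Fin (length xs) → Fin (length ys)
    position i = index (xs⊆ys (∈-lookup i))
    position-injective : Injective _≡_ _≡_ position
    position-injective {i} {j} e = unique⇒lookup-injective xs! (begin
      lookup xs i            ≡⟨ lookup-index (xs⊆ys (∈-lookup i)) ⟩
      lookup ys (position i) ≡⟨ cong (lookup ys) e ⟩
      lookup ys (position j) ≡⟨ lookup-index (xs⊆ys (∈-lookup j)) ⟨
      lookup xs j            ∎)
      where open ≡-Reasoning

  ∈-last : ∀ xs {w ws ys} {b : A} → xs ++ w ∷ ws ≡ ys ∷ʳ b → b ∈ w ∷ ws
  ∈-last []          {ys = ys}    e = subst (_ ∈_) (sym e) (∈-++⁺ʳ ys (here refl))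
  ∈-last (_ ∷ [])    {ys = []}    ()
  ∈-last (_ ∷ _ ∷ _) {ys = []}    ()
  ∈-last (_ ∷ xs)    {ys = _ ∷ _} e = ∈-last xs (∷-injectiveʳ e)

  unique-last∈prefix⇒suffix≡[] : ∀ xs {zs ys} {b : A} →
    Unique (xs ++ zs) → b ∈ xs → xs ++ zs ≡ ys ∷ʳ b → zs ≡ []
  unique-last∈prefix⇒suffix≡[] xs {[]}    _   _    _ = refl
  unique-last∈prefix⇒suffix≡[] xs {_ ∷ _} xs! b∈xs e = ⊥-elim (unique-++-disjoint xs xs! b∈xs (∈-last xs e))

  only-element : ∀ (xs : List A) → length xs ≡ 1 → ∃ λ q → q ∈ xs × (∀ {z} → z ∈ xs → z ≡ q)
  only-element (q ∷ []) _ = q , here refl , λ { (here z≡q) → z≡q }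

length-allFin : ∀ n → length (allFin n) ≡ n
length-allFin n = length-tabulate (λ i → i)

unique⇒length≤ : ∀ {n} {xs : List (Fin n)} → Unique xs → length xs ≤ n
unique⇒length≤ {n} {xs} xs! = subst (length xs ≤_) (length-allFin n) (unique⊆⇒length≤ xs! (λ {y} _ → ∈-allFin y))

fresh : ∀ {k} (xs : List (Fin k)) → length xs < k → ∃ λ c → c ∉ xs
fresh {k} xs |xs|<k with all? (λ c → Any.any? (c ≟_) xs)
... | no ¬all = ¬∀⟶∃¬ k _ (λ c → Any.any? (c ≟_) xs) ¬all
... | yes all = ⊥-elim (ℕ.<-irrefl refl (<-≤-trans |xs|<k k≤|xs|))
  where
  k≤|xs| : k ≤ length xs
  k≤|xs| = subst (_≤ length xs) (length-allFin k) (unique⊆⇒length≤ (allFin⁺ k) (λ {c} _ → all c))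

other-element : ∀ {n} (xs : List (Fin n)) {b} → Unique xs → b ∈ xs → length xs ≢ 1 →
  ∃ λ z → z ∈ xs × z ≢ b
other-element (x ∷ [])     _        _ |xs|≢1 = ⊥-elim (|xs|≢1 refl)
other-element (x ∷ y ∷ xs) {b} (x∉ ∷ _) _ _ with x ≟ b
... | no x≢b   = x , here refl , x≢b
... | yes refl = y , there (here refl) , λ y≡x → All.lookup x∉ (here refl) (sym y≡x)

sum-indicator≡length-filter : ∀ {A : Set} (b : A → Bool) xs →
  sum (map (λ x → if b x then 1 else 0) xs) ≡ length (filter (λ x → b x Bool.≟ true) xs)
sum-indicator≡length-filter b []       = refl
sum-indicator≡length-filter b (x ∷ xs) with b x
... | true  = cong suc (sum-indicator≡length-filter b xs)
... | false = sum-indicator≡length-filter b xs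

≤-foldr-⊔ : ∀ {A : Set} (f : A → ℕ) {x} xs → x ∈ xs → f x ≤ foldr (λ y m → f y ⊔ m) 0 xs
≤-foldr-⊔ f (y ∷ xs) (here refl) = m≤m⊔n (f y) _
≤-foldr-⊔ f (y ∷ xs) (there x∈xs) = ≤-trans (≤-foldr-⊔ f xs x∈xs) (m≤n⊔m (f y) _)

sum-map-mono : ∀ {A : Set} {f g : A → ℕ} xs → (∀ x → f x ≤ g x) → sum (map f xs) ≤ sum (map g xs)
sum-map-mono []       _   = z≤n
sum-map-mono (x ∷ xs) f≤g = ℕ.+-mono-≤ (f≤g x) (sum-map-mono xs f≤g)

neighbours : ∀ {n} → Graph n → Fin n → List (Fin n)
neighbours {n} G v = filter (λ z → adj G v z Bool.≟ true) (allFin n)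

module _ {n : ℕ} (G : Graph n) where

  ∈-neighbours⁺ : ∀ {v z} → adj G v z ≡ true → z ∈ neighbours G v
  ∈-neighbours⁺ {v} {z} vz = ∈-filter⁺ (λ z → adj G v z Bool.≟ true) (∈-allFin z) vz

  ∈-neighbours⁻ : ∀ {v z} → z ∈ neighbours G v → adj G v z ≡ true
  ∈-neighbours⁻ {v} z∈ = proj₂ (∈-filter⁻ (λ z → adj G v z Bool.≟ true) {xs = allFin n} z∈)

  unique-neighbours : ∀ v → Unique (neighbours G v)
  unique-neighbours v = filter⁺ _ (allFin⁺ n)

  deg≡length-neighbours : ∀ v → deg G v ≡ length (neighbours G v)
  deg≡length-neighbours v = sum-indicator≡length-filter (adj G v) (allFin n)

  deg≤maxDeg : ∀ v → deg G v ≤ maxDeg G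
  deg≤maxDeg v = ≤-foldr-⊔ (deg G) (allFin n) (∈-allFin v)

  adj-sym : ∀ {u v} → adj G u v ≡ true → adj G v u ≡ true
  adj-sym {u} {v} uv = trans (Graph.sym G v u) uv

  adj⇒≢ : ∀ {u v} → adj G u v ≡ true → u ≢ v
  adj⇒≢ {u} uv refl with () ← trans (sym (irrefl G u)) uv

  leaf⇒unique-neighbour : ∀ {v} → deg G v ≡ 1 →
    ∃ λ q → adj G v q ≡ true × (∀ {z} → adj G v z ≡ true → z ≡ q)
  leaf⇒unique-neighbour {v} deg≡1
    with q , q∈ , unique ← only-element (neighbours G v) (trans (sym (deg≡length-neighbours v)) deg≡1)
    = q , ∈-neighbours⁻ q∈ , λ vz → unique (∈-neighbours⁺ vz)

  another-neighbour : ∀ {v b} → deg G v ≢ 1 → adj G v b ≡ true → ∃ λ z → adj G v z ≡ true × z ≢ b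
  another-neighbour {v} deg≢1 vb
    with z , z∈ , z≢b ← other-element (neighbours G v) (unique-neighbours v) (∈-neighbours⁺ vb)
                          (λ e → deg≢1 (trans (deg≡length-neighbours v) e))
    = z , ∈-neighbours⁻ z∈ , z≢b

  two-neighbours⇒2≤deg : ∀ {v a b} → adj G v a ≡ true → adj G v b ≡ true → a ≢ b → 2 ≤ deg G v
  two-neighbours⇒2≤deg {v} {a} {b} va vb a≢b = subst (2 ≤_) (sym (deg≡length-neighbours v))
    (unique⊆⇒length≤ {xs = a ∷ b ∷ []} ((a≢b ∷ []) ∷ [] ∷ [])
      λ { (here refl) → ∈-neighbours⁺ va ; (there (here refl)) → ∈-neighbours⁺ vb })

record SquareColoring {n} (G : Graph n) (K : Set) : Set where
  field
    colour  : Fin n → K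
    proper  : ∀ {u v} → adj G u v ≡ true → colour u ≢ colour v
    proper² : ∀ {u w v} → adj G u w ≡ true → adj G w v ≡ true → u ≢ v → colour u ≢ colour v

squareColoring⇒incidenceColoring : ∀ {n} {G : Graph n} {K} → SquareColoring G K → IncidenceColoring G K
squareColoring⇒incidenceColoring {G = G} c = σ , distinct
  where
  open SquareColoring c
  σ : Arc G → _
  σ ((u , v) , _) = colour v
  distinct : ∀ a b → ArcAdj G a b → σ a ≢ σ b
  distinct ((u , v) , uv) ((x , y) , xy) (uv≢xy , inj₁ refl) =
    proper² (adj-sym G uv) xy (λ v≡y → uv≢xy (cong (u ,_) v≡y))
  distinct ((u , v) , uv) ((x , y) , xy) (_ , inj₂ (inj₁ refl)) = proper xy
  distinct ((u , v) , uv) ((x , y) , xy) (_ , inj₂ (inj₂ refl)) = λ e → proper uv (sym e)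

infix 4 _⊆ᴱ_
_⊆ᴱ_ : ∀ {n} → Graph n → Graph n → Set
H ⊆ᴱ G = ∀ {u v} → adj H u v ≡ true → adj G u v ≡ true

module ⊆ᴱ-Properties {n : ℕ} {H G : Graph n} (H⊆G : H ⊆ᴱ G) where

  deg-mono-⊆ᴱ : ∀ v → deg H v ≤ deg G v
  deg-mono-⊆ᴱ v = sum-map-mono (allFin n) indicator-mono
    where
    indicator-mono : ∀ z → (if adj H v z then 1 else 0) ≤ (if adj G v z then 1 else 0)
    indicator-mono z with adj H v z in e
    ... | false = z≤n
    ... | true rewrite H⊆G e = ≤-refl

  bipartite-⊆ᴱ : Bipartite G → Bipartite H
  bipartite-⊆ᴱ (side , proper) = side , λ u v uv → proper u v (H⊆G uv)

  cycle-⊆ᴱ : Cycle H → Cycle G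
  cycle-⊆ᴱ C = record
    { m = m C ; len≥3 = len≥3 C ; vs = vs C ; inj = inj C
    ; step = λ i → H⊆G (step C i) ; close = H⊆G (close C) }

  atMostOneCycle-⊆ᴱ : AtMostOneCycle G → AtMostOneCycle H
  atMostOneCycle-⊆ᴱ unique C D = unique (cycle-⊆ᴱ C) (cycle-⊆ᴱ D)

infixl 6 _∖_
_∖_ : ∀ {n} → Graph n → Fin n → Graph n
G ∖ p = record
  { adj    = λ u v → adj G u v ∧ (keep u ∧ keep v)
  ; sym    = λ u v → cong₂ _∧_ (Graph.sym G u v) (Boolₚ.∧-comm (keep u) (keep v))
  ; irrefl = λ v → cong (_∧ (keep v ∧ keep v)) (irrefl G v) }
  where
  keep : Fin _ → Bool
  keep u = not (does (u ≟ p))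

module _ {n : ℕ} (G : Graph n) (p : Fin n) where

  ∖-⊆ᴱ : G ∖ p ⊆ᴱ G
  ∖-⊆ᴱ {u} {v} uv with adj G u v
  ... | true = refl

  ∖-adj : ∀ {u v} → u ≢ p → v ≢ p → adj (G ∖ p) u v ≡ adj G u v
  ∖-adj {u} {v} u≢p v≢p with u ≟ p | v ≟ p
  ... | yes u≡p | _       = ⊥-elim (u≢p u≡p)
  ... | no _    | yes v≡p = ⊥-elim (v≢p v≡p)
  ... | no _    | no _    = Boolₚ.∧-identityʳ (adj G u v)

  ∖-adj⇒≢ : ∀ {u v} → adj (G ∖ p) u v ≡ true → u ≢ p
  ∖-adj⇒≢ {u} {v} uv refl with p ≟ p | adj G p v
  ... | yes _ | true  = case uv of λ ()
  ... | yes _ | false = case uv of λ ()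
  ... | no p≢p | _    = p≢p refl

extend-at-leaf : ∀ {n} {G : Graph n} {Δ p} → (∀ v → deg G v ≤ Δ) → deg G p ≡ 1 →
  SquareColoring (G ∖ p) (Fin (Δ + 2)) → SquareColoring G (Fin (Δ + 2))
extend-at-leaf {n} {G} {Δ} {p} deg≤Δ leaf c = record { colour = colour ; proper = proper ; proper² = proper² }
  where
  module c = SquareColoring c

  q : Fin n
  q = proj₁ (leaf⇒unique-neighbour G leaf)
  only-q : ∀ {z} → adj G p z ≡ true → z ≡ q
  only-q = proj₂ (proj₂ (leaf⇒unique-neighbour G leaf))

  seen-from-p : List (Fin (Δ + 2))
  seen-from-p = map c.colour (q ∷ neighbours G q)

  few-seen : length seen-from-p < Δ + 2
  few-seen = begin-strict
    length seen-from-p            ≡⟨ length-map c.colour (q ∷ neighbours G q) ⟩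
    suc (length (neighbours G q)) ≡⟨ cong suc (deg≡length-neighbours G q) ⟨
    suc (deg G q)                 ≤⟨ s≤s (deg≤Δ q) ⟩
    suc Δ                         <⟨ ℕ.n<1+n (suc Δ) ⟩
    2 + Δ                         ≡⟨ ℕ.+-comm 2 Δ ⟩
    Δ + 2                         ∎
    where open ℕ.≤-Reasoning

  new : Fin (Δ + 2)
  new = proj₁ (fresh seen-from-p few-seen)
  new∉ : new ∉ seen-from-p
  new∉ = proj₂ (fresh seen-from-p few-seen)

  new-unseen¹ : ∀ {v} → adj G p v ≡ true → new ≢ c.colour v
  new-unseen¹ pv new≡ with refl ← only-q pv = new∉ (here new≡)

  new-unseen² : ∀ {w v} → adj G p w ≡ true → adj G w v ≡ true → new ≢ c.colour v
  new-unseen² pw wv new≡ with refl ← only-q pw = new∉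
    (there (subst (_∈ map c.colour (neighbours G q)) (sym new≡) (∈-map⁺ c.colour (∈-neighbours⁺ G wv))))

  colour : Fin n → Fin (Δ + 2)
  colour v with v ≟ p
  ... | yes _ = new
  ... | no _  = c.colour v

  proper : ∀ {u v} → adj G u v ≡ true → colour u ≢ colour v
  proper {u} {v} uv with u ≟ p | v ≟ p
  ... | yes refl | yes refl = ⊥-elim (adj⇒≢ G uv refl)
  ... | yes refl | no _     = new-unseen¹ uv
  ... | no _     | yes refl = λ e → new-unseen¹ (adj-sym G uv) (sym e)
  ... | no u≢p   | no v≢p   = c.proper (trans (∖-adj G p u≢p v≢p) uv)

  proper² : ∀ {u w v} → adj G u w ≡ true → adj G w v ≡ true → u ≢ v → colour u ≢ colour v
  proper² {u} {w} {v} uw wv u≢v with u ≟ p | v ≟ p | w ≟ p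
  ... | yes refl | yes refl | _       = ⊥-elim (u≢v refl)
  ... | yes refl | no _     | _       = new-unseen² uw wv
  ... | no _     | yes refl | _       = λ e → new-unseen² (adj-sym G wv) (adj-sym G uw) (sym e)
  ... | no _     | no _     | yes refl = ⊥-elim (u≢v (trans (only-q (adj-sym G uw)) (sym (only-q wv))))
  ... | no u≢p   | no v≢p   | no w≢p  =
    c.proper² (trans (∖-adj G p u≢p w≢p) uw) (trans (∖-adj G p w≢p v≢p) wv) u≢v

module Paths {n : ℕ} (G : Graph n) where

  Walk : List (Fin n) → Set
  Walk xs = ∀ {u v} → Consec u v xs → adj G u v ≡ true

  record IsPath (xs : List (Fin n)) : Set where
    field
      unique : Unique xs
      walk   : Walk xs
  open IsPath

  path-++⁻ˡ : ∀ xs {ys} → IsPath (xs ++ ys) → IsPath xs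
  path-++⁻ˡ xs {ys} P = record
    { unique = unique-++⁻ˡ xs (unique P) ; walk = λ c → walk P (consec-++⁺ˡ ys c) }

  path-reverse⁺ : ∀ {xs} → IsPath xs → IsPath (reverse xs)
  path-reverse⁺ {xs} P = record
    { unique = unique-reverse⁺ (unique P)
    ; walk   = λ c → adj-sym G (walk P (subst (Consec _ _) (reverse-involutive xs) (consec-reverse⁺ c))) }

  edge-path : ∀ {x y} → adj G x y ≡ true → IsPath (x ∷ y ∷ [])
  edge-path xy = record
    { unique = (adj⇒≢ G xy ∷ []) ∷ [] ∷ []
    ; walk   = λ { here → xy ; (there (there ())) } }

  path-∷⁺ : ∀ {z h t} → IsPath (h ∷ t) → adj G z h ≡ true → z ∉ h ∷ t → IsPath (z ∷ h ∷ t)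
  path-∷⁺ {h = h} {t} P zh z∉ = record
    { unique = ¬Any⇒All¬ (h ∷ t) z∉ ∷ unique P
    ; walk   = λ { here → zh ; (there c) → walk P c } }

  HeadMaximal : List (Fin n) → Set
  HeadMaximal []      = ⊥
  HeadMaximal (h ∷ t) = ∀ {z} → adj G h z ≡ true → z ∈ h ∷ t

  headMaximal-++⁺ : ∀ xs {ys} → HeadMaximal xs → HeadMaximal (xs ++ ys)
  headMaximal-++⁺ (h ∷ t) max hz = ∈-++⁺ˡ (max hz)

  extend-head : ∀ {h t} → IsPath (h ∷ t) → ∃ λ ws → IsPath (ws ++ h ∷ t) × HeadMaximal (ws ++ h ∷ t)
  extend-head = extend n (ℕ.m≤m+n n _)
    where
    extend : ∀ k {h t} → n ≤ k + length (h ∷ t) → IsPath (h ∷ t) →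
      ∃ λ ws → IsPath (ws ++ h ∷ t) × HeadMaximal (ws ++ h ∷ t)
    extend k {h} {t} n≤ P with any? (λ z → adj G h z Bool.≟ true ×-dec ¬? (Any.any? (z ≟_) (h ∷ t)))
    ... | no blocked = [] , P , λ {z} hz → decidable-stable (Any.any? (z ≟_) (h ∷ t)) (λ z∉ → blocked (z , hz , z∉))
    ... | yes (z , hz , z∉) with k
    ...   | zero = ⊥-elim (ℕ.<-irrefl refl (≤-trans (unique⇒length≤ (unique (path-∷⁺ P (adj-sym G hz) z∉))) n≤))
    ...   | suc k with ws , P′ , max ← extend k (subst (n ≤_) (sym (ℕ.+-suc k _)) n≤) (path-∷⁺ P (adj-sym G hz) z∉)
      = ws ∷ʳ z , subst (λ xs → IsPath xs × HeadMaximal xs) (sym (++-assoc ws [ z ] (h ∷ t))) (P′ , max)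

  record CycleAlong (xs : List (Fin n)) : Set where
    field
      cycle       : Cycle G
      vertices⊆   : ∀ {u v} → CycleEdge cycle u v → u ∈ xs
      consec⇒edge : ∀ {u v} → Consec u v xs → CycleEdge cycle u v

  close-path : ∀ a b s z → IsPath (a ∷ b ∷ s ∷ʳ z) → adj G z a ≡ true → CycleAlong (a ∷ b ∷ s ∷ʳ z)
  close-path a b s z P za = record { cycle = C ; vertices⊆ = vertices⊆ ; consec⇒edge = consec⇒edge }
    where
    t : List (Fin n)
    t = b ∷ s ∷ʳ z
    C : Cycle G
    C = record
      { m     = length t
      ; len≥3 = s≤s (subst (1 ≤_) (sym (length-++ s)) (ℕ.m≤n+m 1 (length s)))
      ; vs    = lookup (a ∷ t)
      ; inj   = unique⇒lookup-injective (unique P)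
      ; step  = λ i → walk P (consec-lookup⁺ a t i)
      ; close = subst (λ w → adj G w a ≡ true) (sym (lookup-last a (b ∷ s) z)) za }
    vertices⊆ : ∀ {u v} → CycleEdge C u v → u ∈ a ∷ t
    vertices⊆ (inj₁ (i , inj₁ (refl , _))) = ∈-lookup (inject₁ i)
    vertices⊆ (inj₁ (i , inj₂ (_ , refl))) = ∈-lookup (fsuc i)
    vertices⊆ (inj₂ (inj₁ (refl , _)))     = ∈-lookup (fromℕ (length t))
    vertices⊆ (inj₂ (inj₂ (_ , refl)))     = ∈-lookup fzero
    consec⇒edge : ∀ {u v} → Consec u v (a ∷ t) → CycleEdge C u v
    consec⇒edge c with i , u≡ , v≡ ← consec-lookup⁻ a t c = inj₁ (i , inj₁ (u≡ , v≡))

  record HeadCycle (b₀ b₁ : Fin n) (rest : List (Fin n)) : Set where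
    field
      prefix suffix : List (Fin n)
      split         : b₀ ∷ b₁ ∷ rest ≡ prefix ++ suffix
      along         : CycleAlong prefix
      first         : Consec b₀ b₁ prefix

  -- The first vertex has a second neighbour, which must lie further along the path.
  head-cycle : ∀ {b₀ b₁ rest} → deg G b₀ ≢ 1 → IsPath (b₀ ∷ b₁ ∷ rest) → HeadMaximal (b₀ ∷ b₁ ∷ rest) →
    HeadCycle b₀ b₁ rest
  head-cycle {b₀} {b₁} deg≢1 P max
    with z , b₀z , z≢b₁ ← another-neighbour G deg≢1 (walk P here)
    with max b₀z
  ... | here z≡b₀         = ⊥-elim (adj⇒≢ G b₀z (sym z≡b₀))
  ... | there (here z≡b₁) = ⊥-elim (z≢b₁ z≡b₁)
  ... | there (there z∈rest) with s , zs , refl ← ∈-∃++ z∈rest = record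
    { prefix = b₀ ∷ b₁ ∷ s ∷ʳ z ; suffix = zs ; split = split
    ; along  = close-path b₀ b₁ s z (path-++⁻ˡ (b₀ ∷ b₁ ∷ s ∷ʳ z) (subst IsPath split P)) (adj-sym G b₀z)
    ; first  = here }
    where
    split : b₀ ∷ b₁ ∷ s ++ [ z ] ++ zs ≡ (b₀ ∷ b₁ ∷ s ∷ʳ z) ++ zs
    split = cong (λ r → b₀ ∷ b₁ ∷ r) (sym (++-assoc s [ z ] zs))

  module _ (no-leaf : ∀ v → deg G v ≢ 1) (one-cycle : AtMostOneCycle G) where

    -- The cycle closed at the far end runs through b₀, hence (being unique) it is the cycle closed
    -- at the near end, and the latter can only contain b₀ if it uses the whole path.
    both-ends-maximal⇒cycle-along : ∀ {b₀ b₁ rest} → IsPath (b₀ ∷ b₁ ∷ rest) →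
      HeadMaximal (b₀ ∷ b₁ ∷ rest) → HeadMaximal (reverse (b₀ ∷ b₁ ∷ rest)) → CycleAlong (b₀ ∷ b₁ ∷ rest)
    both-ends-maximal⇒cycle-along {b₀} {b₁} {rest} P max max-rev
      with reverse (b₀ ∷ b₁ ∷ rest) in rev≡
    ... | r ∷ [] = case trans (sym (length-reverse (b₀ ∷ b₁ ∷ rest))) (cong length rev≡) of λ ()
    ... | r₀ ∷ r₁ ∷ rest′ = subst CycleAlong (sym xs≡prefix) (HeadCycle.along near)
      where
      far : HeadCycle r₀ r₁ rest′
      far = head-cycle (no-leaf r₀) (subst IsPath rev≡ (path-reverse⁺ P)) max-rev
      near : HeadCycle b₀ b₁ rest
      near = head-cycle (no-leaf b₀) P max
      open HeadCycle near using (prefix; suffix; split)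
      module far  = CycleAlong (HeadCycle.along far)
      module near = CycleAlong (HeadCycle.along near)
      r₀∈prefix : r₀ ∈ prefix
      r₀∈prefix = near.vertices⊆ (proj₁ (one-cycle far.cycle near.cycle r₀ r₁) (far.consec⇒edge (HeadCycle.first far)))
      ends-in-r₀ : prefix ++ suffix ≡ reverse (r₁ ∷ rest′) ∷ʳ r₀
      ends-in-r₀ = begin
        prefix ++ suffix                   ≡⟨ split ⟨
        b₀ ∷ b₁ ∷ rest                     ≡⟨ reverse-involutive (b₀ ∷ b₁ ∷ rest) ⟨
        reverse (reverse (b₀ ∷ b₁ ∷ rest)) ≡⟨ cong reverse rev≡ ⟩
        reverse (r₀ ∷ r₁ ∷ rest′)          ≡⟨ unfold-reverse r₀ (r₁ ∷ rest′) ⟩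
        reverse (r₁ ∷ rest′) ∷ʳ r₀         ∎
        where open ≡-Reasoning
      xs≡prefix : b₀ ∷ b₁ ∷ rest ≡ prefix
      xs≡prefix = begin
        b₀ ∷ b₁ ∷ rest   ≡⟨ split ⟩
        prefix ++ suffix ≡⟨ cong (prefix ++_) (unique-last∈prefix⇒suffix≡[] prefix
                              (subst Unique split (unique P)) r₀∈prefix ends-in-r₀) ⟩
        prefix ++ []     ≡⟨ ++-identityʳ prefix ⟩
        prefix           ∎
        where open ≡-Reasoning

    consec⇒cycleEdge : ∀ {xs} → IsPath xs → HeadMaximal xs → HeadMaximal (reverse xs) →
      ∀ {x y} → Consec x y xs → Σ (Cycle G) λ D → CycleEdge D x y
    consec⇒cycleEdge {_ ∷ []} _ _ _ (there ())
    consec⇒cycleEdge {_ ∷ _ ∷ _} P max max-rev c = cycle , consec⇒edge c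
      where open CycleAlong (both-ends-maximal⇒cycle-along P max max-rev)

    edge⇒cycleEdge : ∀ {x y} → adj G x y ≡ true → Σ (Cycle G) λ D → CycleEdge D x y
    edge⇒cycleEdge {x} {y} xy
      with ws , P₁ , max₁ ← extend-head (edge-path (adj-sym G xy))
      with ws′ , P , max ← extend-head (subst IsPath (reverse-++ ws (y ∷ x ∷ [])) (path-reverse⁺ P₁))
      = consec⇒cycleEdge P max (subst HeadMaximal (sym reverse-path) (headMaximal-++⁺ (ws ++ y ∷ x ∷ []) max₁))
          (consec-++⁺ʳ ws′ here)
      where
      open ≡-Reasoning
      reverse-path : reverse (ws′ ++ x ∷ y ∷ reverse ws) ≡ (ws ++ y ∷ x ∷ []) ++ reverse ws′
      reverse-path = begin
        reverse (ws′ ++ x ∷ y ∷ reverse ws)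
          ≡⟨ reverse-++ ws′ _ ⟩
        reverse (x ∷ y ∷ reverse ws) ++ reverse ws′
          ≡⟨ cong (λ l → reverse l ++ reverse ws′) (reverse-++ ws (y ∷ x ∷ [])) ⟨
        reverse (reverse (ws ++ y ∷ x ∷ [])) ++ reverse ws′
          ≡⟨ cong (_++ reverse ws′) (reverse-involutive (ws ++ y ∷ x ∷ [])) ⟩
        (ws ++ y ∷ x ∷ []) ++ reverse ws′ ∎

open Paths using (edge⇒cycleEdge)

data Next {m : ℕ} : Fin (suc m) → Fin (suc m) → Set where
  inner : ∀ i → Next (inject₁ i) (fsuc i)
  wrap  : Next (fromℕ m) fzero

Adjacent : ∀ {m} → Fin (suc m) → Fin (suc m) → Set
Adjacent a b = Next a b ⊎ Next b a

next-injective : ∀ {m} {a b c : Fin (suc m)} → Next a c → Next b c → a ≡ b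
next-injective (inner i) (inner .i) = refl
next-injective wrap      wrap       = refl

next-functional : ∀ {m} {a a′ b c : Fin (suc m)} → Next a b → Next a′ c → a ≡ a′ → b ≡ c
next-functional (inner i) (inner j) e = cong fsuc (inject₁-injective e)
next-functional (inner i) wrap      e = ⊥-elim (fromℕ≢inject₁ (sym e))
next-functional wrap      (inner j) e = ⊥-elim (fromℕ≢inject₁ e)
next-functional wrap      wrap      _ = refl

module CyclicColouring {K : Set} (m : ℕ) (f : ℕ → K)
  (f-suc : ∀ i → f i ≢ f (suc i)) (f-suc² : ∀ i → f i ≢ f (suc (suc i)))
  (wrap₀ : f (suc m) ≡ f 0) (wrap₁ : f (suc (suc m)) ≡ f 1) where

  colour : Fin (suc m) → K
  colour a = f (toℕ a)

  next-colour : ∀ {a b : Fin (suc m)} → Next a b → colour b ≡ f (suc (toℕ a))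
  next-colour (inner i) = cong (f ∘ suc) (sym (toℕ-inject₁ i))
  next-colour wrap      = trans (sym wrap₀) (cong (f ∘ suc) (sym (toℕ-fromℕ m)))

  next-colour² : ∀ {a b : Fin (suc m)} → Next a b → f (suc (toℕ b)) ≡ f (suc (suc (toℕ a)))
  next-colour² (inner i) = cong (f ∘ suc ∘ suc) (sym (toℕ-inject₁ i))
  next-colour² wrap      = trans (sym wrap₁) (cong (f ∘ suc ∘ suc) (sym (toℕ-fromℕ m)))

  next-proper : ∀ {a b : Fin (suc m)} → Next a b → colour a ≢ colour b
  next-proper {a} ab e = f-suc (toℕ a) (trans e (next-colour ab))

  next²-proper : ∀ {a b c : Fin (suc m)} → Next a b → Next b c → colour a ≢ colour c
  next²-proper {a} ab bc e = f-suc² (toℕ a) (trans e (trans (next-colour bc) (next-colour² ab)))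

  adjacent-proper : ∀ {a b : Fin (suc m)} → Adjacent a b → colour a ≢ colour b
  adjacent-proper (inj₁ ab) = next-proper ab
  adjacent-proper (inj₂ ba) = next-proper ba ∘ sym

  adjacent²-proper : ∀ {a b c : Fin (suc m)} → Adjacent a b → Adjacent b c → a ≢ c → colour a ≢ colour c
  adjacent²-proper (inj₁ ab) (inj₁ bc) _   = next²-proper ab bc
  adjacent²-proper (inj₂ ba) (inj₂ cb) _   = next²-proper cb ba ∘ sym
  adjacent²-proper (inj₁ ab) (inj₂ cb) a≢c = ⊥-elim (a≢c (next-injective ab cb))
  adjacent²-proper (inj₂ ba) (inj₁ bc) a≢c = ⊥-elim (a≢c (next-functional ba bc refl))

cycleEdge⇒adjacent : ∀ {n} {G : Graph n} (C : Cycle G) {u v} → CycleEdge C u v →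
  ∃₂ λ a b → u ≡ vs C a × v ≡ vs C b × Adjacent a b
cycleEdge⇒adjacent C (inj₁ (i , inj₁ (u≡ , v≡))) = inject₁ i , fsuc i , u≡ , v≡ , inj₁ (inner i)
cycleEdge⇒adjacent C (inj₁ (i , inj₂ (v≡ , u≡))) = fsuc i , inject₁ i , u≡ , v≡ , inj₂ (inner i)
cycleEdge⇒adjacent C (inj₂ (inj₁ (u≡ , v≡)))     = fromℕ _ , fzero , u≡ , v≡ , inj₁ wrap
cycleEdge⇒adjacent C (inj₂ (inj₂ (v≡ , u≡)))     = fzero , fromℕ _ , u≡ , v≡ , inj₂ wrap

cycle-squareColoring : ∀ {n} {G : Graph n} (C : Cycle G) → (∀ {u v} → adj G u v ≡ true → CycleEdge C u v) →
  ∀ {K} (f : ℕ → K) → (∀ i → f i ≢ f (suc i)) → (∀ i → f i ≢ f (suc (suc i))) →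
  f (suc (m C)) ≡ f 0 → f (suc (suc (m C))) ≡ f 1 → SquareColoring G K
cycle-squareColoring {n} {G} C on-C {K} f f-suc f-suc² wrap₀ wrap₁ =
  record { colour = colour ; proper = proper ; proper² = proper² }
  where
  open CyclicColouring (m C) f f-suc f-suc² wrap₀ wrap₁ renaming (colour to colourᶜ)

  colour : Fin n → K
  colour v with any? (λ a → vs C a ≟ v)
  ... | yes (a , _) = colourᶜ a
  ... | no _        = f 0

  colour-vs : ∀ a → colour (vs C a) ≡ colourᶜ a
  colour-vs a with any? (λ b → vs C b ≟ vs C a)
  ... | yes (b , e) = cong colourᶜ (inj C e)
  ... | no ∄        = ⊥-elim (∄ (a , refl))

  proper : ∀ {u v} → adj G u v ≡ true → colour u ≢ colour v
  proper uv with a , b , refl , refl , ab ← cycleEdge⇒adjacent C (on-C uv) =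
    λ e → adjacent-proper ab (trans (sym (colour-vs a)) (trans e (colour-vs b)))

  proper² : ∀ {u w v} → adj G u w ≡ true → adj G w v ≡ true → u ≢ v → colour u ≢ colour v
  proper² uw wv u≢v
    with a , b , refl , refl , ab ← cycleEdge⇒adjacent C (on-C uw)
    with b′ , c , vs-b≡vs-b′ , refl , b′c ← cycleEdge⇒adjacent C (on-C wv)
    with refl ← inj C vs-b≡vs-b′ =
    λ e → adjacent²-proper ab b′c (u≢v ∘ cong (vs C)) (trans (sym (colour-vs a)) (trans e (colour-vs c)))

threes : ℕ → Fin 4
threes 0 = # 0
threes 1 = # 1
threes 2 = # 2
threes (suc (suc (suc i))) = threes i

foursThenThrees : ℕ → ℕ → Fin 4
foursThenThrees zero    i = threes i
foursThenThrees (suc r) 0 = # 0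
foursThenThrees (suc r) 1 = # 1
foursThenThrees (suc r) 2 = # 2
foursThenThrees (suc r) 3 = # 3
foursThenThrees (suc r) (suc (suc (suc (suc i)))) = foursThenThrees r i

threes-suc : ∀ i → threes i ≢ threes (suc i)
threes-suc 0 ()
threes-suc 1 ()
threes-suc 2 ()
threes-suc (suc (suc (suc i))) = threes-suc i

threes-suc² : ∀ i → threes i ≢ threes (suc (suc i))
threes-suc² 0 ()
threes-suc² 1 ()
threes-suc² 2 ()
threes-suc² (suc (suc (suc i))) = threes-suc² i

threes-period : ∀ q j → threes (q * 3 + j) ≡ threes j
threes-period zero    j = refl
threes-period (suc q) j = threes-period q j

foursThenThrees-start : ∀ r j → j < 3 → foursThenThrees r j ≡ threes j
foursThenThrees-start zero    j _ = refl
foursThenThrees-start (suc r) 0 _ = refl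
foursThenThrees-start (suc r) 1 _ = refl
foursThenThrees-start (suc r) 2 _ = refl
foursThenThrees-start (suc r) (suc (suc (suc j))) (s≤s (s≤s (s≤s ())))

foursThenThrees-suc : ∀ r i → foursThenThrees r i ≢ foursThenThrees r (suc i)
foursThenThrees-suc zero    i = threes-suc i
foursThenThrees-suc (suc r) 0 ()
foursThenThrees-suc (suc r) 1 ()
foursThenThrees-suc (suc r) 2 ()
foursThenThrees-suc (suc r) 3 e with () ← trans e (foursThenThrees-start r 0 (s≤s z≤n))
foursThenThrees-suc (suc r) (suc (suc (suc (suc i)))) = foursThenThrees-suc r i

foursThenThrees-suc² : ∀ r i → foursThenThrees r i ≢ foursThenThrees r (suc (suc i))
foursThenThrees-suc² zero    i = threes-suc² i
foursThenThrees-suc² (suc r) 0 ()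
foursThenThrees-suc² (suc r) 1 ()
foursThenThrees-suc² (suc r) 2 e with () ← trans e (foursThenThrees-start r 0 (s≤s z≤n))
foursThenThrees-suc² (suc r) 3 e with () ← trans e (foursThenThrees-start r 1 (s≤s (s≤s z≤n)))
foursThenThrees-suc² (suc r) (suc (suc (suc (suc i)))) = foursThenThrees-suc² r i

foursThenThrees-shift : ∀ r j → foursThenThrees r (r * 4 + j) ≡ threes j
foursThenThrees-shift zero    j = refl
foursThenThrees-shift (suc r) j = foursThenThrees-shift r j

foursThenThrees-periodic : ∀ r q j → j < 3 → foursThenThrees r (r * 4 + q * 3 + j) ≡ foursThenThrees r j
foursThenThrees-periodic r q j j<3 = begin
  foursThenThrees r (r * 4 + q * 3 + j)   ≡⟨ cong (foursThenThrees r) (ℕ.+-assoc (r * 4) (q * 3) j) ⟩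
  foursThenThrees r (r * 4 + (q * 3 + j)) ≡⟨ foursThenThrees-shift r (q * 3 + j) ⟩
  threes (q * 3 + j)                      ≡⟨ threes-period q j ⟩
  threes j                                ≡⟨ foursThenThrees-start r j j<3 ⟨
  foursThenThrees r j                     ∎
  where open ≡-Reasoning

sum-of-fours-and-threes : ∀ N → 3 ≤ N → N ≢ 5 → ∃₂ λ r q → N ≡ r * 4 + q * 3
sum-of-fours-and-threes 1 (s≤s ()) _
sum-of-fours-and-threes 2 (s≤s (s≤s ())) _
sum-of-fours-and-threes 3 _ _ = 0 , 1 , refl
sum-of-fours-and-threes 4 _ _ = 1 , 0 , refl
sum-of-fours-and-threes 5 _ 5≢5 = ⊥-elim (5≢5 refl)
sum-of-fours-and-threes 6 _ _ = 0 , 2 , refl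
sum-of-fours-and-threes 7 _ _ = 1 , 1 , refl
sum-of-fours-and-threes 8 _ _ = 2 , 0 , refl
sum-of-fours-and-threes (suc (suc (suc (suc (suc (suc (suc (suc (suc N))))))))) _ _
  with r , q , e ← sum-of-fours-and-threes (6 + N) (s≤s (s≤s (s≤s z≤n))) (λ ())
  = r , suc q , trans (cong (3 +_) e) (x∙yz≈y∙xz 3 (r * 4) (q * 3))

≢-≢⇒≡ : ∀ {a b c : Bool} → a ≢ b → b ≢ c → a ≡ c
≢-≢⇒≡ a≢b b≢c = trans (Boolₚ.¬-not a≢b) (sym (Boolₚ.¬-not (b≢c ∘ sym)))

no-closed-walk₅ : ∀ {n} {G : Graph n} → Bipartite G → ∀ {k} → k ≡ 4 → (w : Fin (suc k) → Fin n) →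
  (∀ i → adj G (w (inject₁ i)) (w (fsuc i)) ≡ true) → adj G (w (fromℕ k)) (w fzero) ≡ true → ⊥
no-closed-walk₅ (side , proper) refl w walk closed = proper _ _ closed (sym (trans side₀≡side₂ side₂≡side₄))
  where
  side₀≡side₂ : side (w (# 0)) ≡ side (w (# 2))
  side₀≡side₂ = ≢-≢⇒≡ (proper _ _ (walk (# 0))) (proper _ _ (walk (# 1)))
  side₂≡side₄ : side (w (# 2)) ≡ side (w (# 4))
  side₂≡side₄ = ≢-≢⇒≡ (proper _ _ (walk (# 2))) (proper _ _ (walk (# 3)))

bipartite⇒length≢5 : ∀ {n} {G : Graph n} → Bipartite G → (C : Cycle G) → suc (m C) ≢ 5
bipartite⇒length≢5 {G = G} bip C e = no-closed-walk₅ {G = G} bip (ℕ.suc-injective e) (vs C) (step C) (close C)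

edgeless-squareColoring : ∀ {n} {G : Graph n} {K} → (∀ u v → adj G u v ≢ true) → K → SquareColoring G K
edgeless-squareColoring no-edge k = record
  { colour = λ _ → k ; proper = λ uv → ⊥-elim (no-edge _ _ uv) ; proper² = λ uw → ⊥-elim (no-edge _ _ uw) }

fourThreeColoring : ∀ {n} {G : Graph n} (C : Cycle G) → (∀ {u v} → adj G u v ≡ true → CycleEdge C u v) →
  ∀ {k} r q → suc (m C) ≡ r * 4 + q * 3 → 4 ≤ k → SquareColoring G (Fin k)
fourThreeColoring C on-C r q length≡ 4≤k =
  cycle-squareColoring C on-C (embed ∘ foursThenThrees r)
    (λ i → foursThenThrees-suc r i ∘ embed-injective) (λ i → foursThenThrees-suc² r i ∘ embed-injective)
    (cong embed wrap₀) (cong embed wrap₁)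
  where
  embed : Fin 4 → Fin _
  embed i = Fin.inject≤ i 4≤k
  embed-injective : ∀ {i j} → embed i ≡ embed j → i ≡ j
  embed-injective = inject≤-injective _ _ _ _
  wrap₀ : foursThenThrees r (suc (m C)) ≡ foursThenThrees r 0
  wrap₀ = trans (cong (foursThenThrees r) (trans length≡ (sym (ℕ.+-identityʳ (r * 4 + q * 3)))))
                (foursThenThrees-periodic r q 0 (s≤s z≤n))
  wrap₁ : foursThenThrees r (suc (suc (m C))) ≡ foursThenThrees r 1
  wrap₁ = trans (cong (foursThenThrees r) (trans (cong suc length≡) (ℕ.+-comm 1 (r * 4 + q * 3))))
                (foursThenThrees-periodic r q 1 (s≤s (s≤s z≤n)))

-- Without leaves every edge lies on a cycle, so the graph is its unique cycle plus isolated vertices.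
leafless-squareColoring : ∀ {n} {G : Graph n} {Δ} → (∀ v → deg G v ≢ 1) → (∀ v → deg G v ≤ Δ) →
  Bipartite G → AtMostOneCycle G → SquareColoring G (Fin (Δ + 2))
leafless-squareColoring {n} {G} {Δ} no-leaf deg≤Δ bip one-cycle
  with any? (λ u → any? (λ v → adj G u v Bool.≟ true))
... | no ∄edge = edgeless-squareColoring (λ u v uv → ∄edge (u , v , uv)) (Δ Fin.↑ʳ fzero)
... | yes (x , y , xy)
  with C , _ ← edge⇒cycleEdge G no-leaf one-cycle xy
  with r , q , length≡ ← sum-of-fours-and-threes (suc (m C)) (s≤s (len≥3 C)) (bipartite⇒length≢5 bip C)
  = fourThreeColoring C on-C r q length≡ (ℕ.+-monoˡ-≤ 2 2≤Δ)
  where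
  on-C : ∀ {u v} → adj G u v ≡ true → CycleEdge C u v
  on-C {u} {v} uv with D , uv∈D ← edge⇒cycleEdge G no-leaf one-cycle uv = proj₁ (one-cycle D C u v) uv∈D
  2≤Δ : 2 ≤ Δ
  2≤Δ with z , xz , z≢y ← another-neighbour G (no-leaf x) xy =
    ≤-trans (two-neighbours⇒2≤deg G xy xz (z≢y ∘ sym)) (deg≤Δ x)

-- Induction on a list A containing every non-isolated vertex; deleting a leaf shortens it.
squareColoring-within : ∀ {n Δ} k (A : List (Fin n)) {G : Graph n} → length A ≤ k →
  (∀ {u v} → adj G u v ≡ true → u ∈ A) → (∀ v → deg G v ≤ Δ) → Bipartite G → AtMostOneCycle G →
  SquareColoring G (Fin (Δ + 2))
squareColoring-within {Δ = Δ} zero [] _ edges⊆[] _ _ _ =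
  edgeless-squareColoring (λ u v uv → case edges⊆[] uv of λ ()) (Δ Fin.↑ʳ fzero)
squareColoring-within (suc k) A {G} |A|≤1+k edges⊆A deg≤Δ bip one-cycle with any? (λ v → deg G v ℕ.≟ 1)
... | no ∄leaf = leafless-squareColoring (λ v leaf → ∄leaf (v , leaf)) deg≤Δ bip one-cycle
... | yes (p , leaf) = extend-at-leaf deg≤Δ leaf
  (squareColoring-within k A′ (ℕ.≤-pred (≤-trans |A′|<|A| |A|≤1+k)) edges⊆A′
    (λ v → ≤-trans (deg-mono-⊆ᴱ v) (deg≤Δ v)) (bipartite-⊆ᴱ bip) (atMostOneCycle-⊆ᴱ one-cycle))
  where
  open ⊆ᴱ-Properties {H = G ∖ p} {G} (∖-⊆ᴱ G p)
  A′ : List (Fin _)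
  A′ = filter (λ v → ¬? (v ≟ p)) A
  p∈A : p ∈ A
  p∈A = edges⊆A (proj₁ (proj₂ (leaf⇒unique-neighbour G leaf)))
  |A′|<|A| : length A′ < length A
  |A′|<|A| = filter-notAll (λ v → ¬? (v ≟ p)) A (Any.map (λ p≡v v≢p → v≢p (sym p≡v)) p∈A)
  edges⊆A′ : ∀ {u v} → adj (G ∖ p) u v ≡ true → u ∈ A′
  edges⊆A′ uv = ∈-filter⁺ (λ v → ¬? (v ≟ p)) (edges⊆A (∖-⊆ᴱ G p uv)) (∖-adj⇒≢ G p uv)

squareColoring : ∀ {n} {G : Graph n} {Δ} → (∀ v → deg G v ≤ Δ) → Bipartite G → AtMostOneCycle G →
  SquareColoring G (Fin (Δ + 2))
squareColoring {n} = squareColoring-within n (allFin n) (ℕ.≤-reflexive (length-allFin n)) (λ {u} _ → ∈-allFin u)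

corollary2p4 : ∀ (n : ℕ) (B : Graph n) → Bipartite B → AtMostOneCycle B →
    χi≤ B (maxDeg B + 2)
corollary2p4 n B bip one-cycle = squareColoring⇒incidenceColoring (squareColoring (deg≤maxDeg B) bip one-cycle)
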